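{- Let $G$ be a group of order $t$ and let $k,\ell$ be positive integers. If $G$ has a Roman-$k$ $\ell$-tuple, then there exists an $\ell t \times t$ Roman-$k$ design.
   Context: For a finite group $G$ of order $t$ and an arrangement $\mathbf{a} = (a_1, \ldots, a_t)$ of the elements of $G$ (each element appearing exactly once), the quotient triangle of $\mathbf{a}$ consists of the lines $T_1, \ldots, T_{t-1}$, where line $T_j$ is the sequence $(a_1^{ -1}a_{1+j}, a_2^{ -1}a_{2+j}, \ldots, a_{t-j}^{ -1}a_t)$. Let $\mathbf{A} = (\mathbf{a}_1, \ldots, \mathbf{a}_\ell)$ be an $\ell$-tuple of arrangements of the elements of $G$, let $T_{i,1}, \ldots, T_{i,t-1}$ be the lines of the quotient triangle of $\mathbf{a}_i$, and for each $j$ let $U_j$ be the concatenation of $T_{1,j}, T_{2,j}, \ldots, T_{\ell,j}$. Then $\mathbf{A}$ is a Roman-$k$ $\ell$-tuple if every non-identity element of $G$ appears at most $\ell$ times in $U_j$ for each $1 \le j \le k$. A crossover design with $n$ subjects and $t$ treatments and periods is an $n \times t$ array $D$ of treatments ($D_{ij}$ = treatment given to subject $i$ in period $j$), assumed uniform: each treatment occurs exactly once in each row and exactly $n/t$ times in each column. For distinct treatments $x,y$ and $1\le d\le t-1$, $o_d(x,y)$ is the number of times, over all rows, that $y$ occurs exactly $d$ periods after $x$ in the same row. The design is Roman-$k$ if $o_d(x,y) \le n/t$ for all ordered pairs of distinct treatments and all $1 \le d \le k$. An "$\ell t \times t$ design" has $\ell t$ rows. -}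

module Defs where

open import Data.Nat using (ℕ; zero; suc; _+_; _*_; _≤_)
open import Data.Nat.Properties using () renaming (_≟_ to _≟ℕ_)
open import Data.Fin using (Fin; toℕ)
open import Data.Fin.Properties using () renaming (_≟_ to _≟F_)
open import Data.List using (List; map)
open import Data.Nat.ListAction using (sum)
open import Data.List using (allFin)
open import Data.Product using (_×_; _,_)
open import Data.Bool using (if_then_else_)
open import Relation.Nullary using (Dec; ¬_; _×-dec_)
open import Relation.Nullary.Decidable using (⌊_⌋)
open import Relation.Binary.PropositionalEquality using (_≡_)
open import Function.Definitions using (Bijective)
open import Algebra.Structures using (IsGroup)

count : (n : ℕ) {P : Fin n → Set} → ((i : Fin n) → Dec (P i)) → ℕ
count n P? = sum (map (λ i → if ⌊ P? i ⌋ then 1 else 0) (allFin n))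

sumF : (n : ℕ) → (Fin n → ℕ) → ℕ
sumF n f = sum (map f (allFin n))

-- A group of order t: a group structure (with propositional equality) on the
-- t-element set Fin t.  Every finite group of order t is isomorphic to one of these.
record FinGroup (t : ℕ) : Set where
  field
    _∙_   : Fin t → Fin t → Fin t
    ε     : Fin t
    _⁻¹   : Fin t → Fin t
    isGroup : IsGroup _≡_ _∙_ ε _⁻¹

-- an arrangement of the elements of G (a_1,...,a_t), indexed from 0
record Arrangement (t : ℕ) : Set where
  field
    arr : Fin t → Fin t
    bij : Bijective _≡_ _≡_ arr

module _ {t : ℕ} (G : FinGroup t) where
  open FinGroup G

  -- number of times g occurs in line T_j of the quotient triangle of a:
  -- pairs of positions (i , i') with i' = i + j and a_i⁻¹ a_{i'} = g
  occLine : Arrangement t → ℕ → Fin t → ℕ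
  occLine a j g = sumF t (λ i → count t (λ i' →
      (toℕ i' ≟ℕ (toℕ i + j)) ×-dec (((Arrangement.arr a i ⁻¹) ∙ Arrangement.arr a i') ≟F g)))

  -- number of times g occurs in U_j (concatenation over the ℓ-tuple)
  occU : {ℓ : ℕ} → (Fin ℓ → Arrangement t) → ℕ → Fin t → ℕ
  occU {ℓ} A j g = sumF ℓ (λ r → occLine (A r) j g)

  RomanTuple : (k ℓ : ℕ) → (Fin ℓ → Arrangement t) → Set
  RomanTuple k ℓ A = (g : Fin t) → ¬ (g ≡ ε) → (j : ℕ) → 1 ≤ j → j ≤ k → occU A j g ≤ ℓ

-- Crossover designs with n subjects and t treatments/periods: D i p = treatment of
-- subject i in period p; treatments are the elements of Fin t.
Design : (n t : ℕ) → Set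
Design n t = Fin n → Fin t → Fin t

Uniform : (m t : ℕ) → Design (m * t) t → Set
Uniform m t D =
  ((i : Fin (m * t)) (x : Fin t) → count t (λ p → D i p ≟F x) ≡ 1) ×
  ((p : Fin t) (x : Fin t) → count (m * t) (λ i → D i p ≟F x) ≡ m)

o : {n t : ℕ} → Design n t → ℕ → Fin t → Fin t → ℕ
o {n} {t} D d x y = sumF n (λ i → sumF t (λ p → count t (λ p' →
    (toℕ p' ≟ℕ (toℕ p + d)) ×-dec ((D i p ≟F x) ×-dec (D i p' ≟F y)))))

-- Roman-k (for n = m * t, so n/t = m)
RomanDesign : (k m t : ℕ) → Design (m * t) t → Set
RomanDesign k m t D = (x y : Fin t) → ¬ (x ≡ y) → (d : ℕ) → 1 ≤ d → d ≤ k → o D d x y ≤ m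

-- Develop the ℓ-tuple: row (r, g) of the design is g·aᵣ.  Left translation permutes G,
-- so every row contains each treatment once and every column meets each treatment once
-- per arrangement.  Left translation also preserves quotients, (g a)⁻¹(g b) = a⁻¹ b, and
-- g is determined by g a = x; hence the occurrences of y exactly d periods after x in
-- the rows developed from aᵣ inject into the occurrences of x⁻¹y in line d of the
-- quotient triangle of aᵣ.  Summing over r bounds o_d(x, y) by the number of occurrences
-- of the non-identity element x⁻¹y in U_d, which is at most ℓ by the Roman-k hypothesis.
module Submission where

open import Defs
open import Data.Nat using (ℕ; zero; suc; _+_; _*_; _≤_; z≤n; s≤s)
open import Data.Fin using (Fin; zero; suc; toℕ; combine; remQuot; _↑ˡ_; _↑ʳ_)
open import Data.Product using (Σ; _×_; _,_; proj₁; proj₂)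

open import Algebra.Bundles using (Group)
import Algebra.Properties.Group as GroupProperties
import Algebra.Properties.Quasigroup as QuasigroupProperties
open import Data.Bool using (if_then_else_)
open import Data.Fin.Properties using (remQuot-combine; suc-injective) renaming (_≟_ to _≟F_)
open import Data.List using (tabulate)
open import Data.List.Properties using (map-tabulate)
import Data.Nat.ListAction as List
open import Data.Nat.Properties
  using (+-*-semiring; +-assoc; ≤-reflexive; +-mono-≤; *-monoʳ-≤; module ≤-Reasoning)
  renaming (_≟_ to _≟ℕ_)
open import Algebra.Properties.Semiring.Sum +-*-semiring
  using (sum-syntax; sum-cong-≗; ∑-comm; *-distribˡ-sum)
open import Function using (_∘_; id; case_of_)
open import Function.Definitions using (Bijective)
import Function.Construct.Composition as Composition
open import Relation.Nullary using (Dec; yes; no; ¬_; _×-dec_)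
open import Relation.Nullary.Decidable using (⌊_⌋)
open import Relation.Binary.PropositionalEquality
  using (_≡_; _≢_; refl; sym; trans; cong; cong₂; module ≡-Reasoning)

indicator : {P : Set} → Dec P → ℕ
indicator P? = if ⌊ P? ⌋ then 1 else 0

indicator-yes : {P : Set} (P? : Dec P) → P → indicator P? ≡ 1
indicator-yes (yes _) _ = refl
indicator-yes (no ¬p) p = case ¬p p of λ ()

indicator-no : {P : Set} (P? : Dec P) → ¬ P → indicator P? ≡ 0
indicator-no (yes p) ¬p = case ¬p p of λ ()
indicator-no (no _) _ = refl

indicator-× : {P Q : Set} (P? : Dec P) (Q? : Dec Q) →
  indicator (P? ×-dec Q?) ≡ indicator P? * indicator Q?
indicator-× (yes _) (yes _) = refl
indicator-× (yes _) (no _) = refl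
indicator-× (no _) _ = refl

indicator-×-≤ˡ : {P Q : Set} (P? : Dec P) (Q? : Dec Q) →
  indicator (P? ×-dec Q?) ≤ indicator P?
indicator-×-≤ˡ (yes _) (yes _) = s≤s z≤n
indicator-×-≤ˡ (yes _) (no _) = z≤n
indicator-×-≤ˡ (no _) _ = z≤n

∑-tabulate : ∀ n (f : Fin n → ℕ) → List.sum (tabulate f) ≡ ∑[ i < n ] f i
∑-tabulate zero f = refl
∑-tabulate (suc n) f = cong (f zero +_) (∑-tabulate n (f ∘ suc))

sumF≡∑ : ∀ n (f : Fin n → ℕ) → sumF n f ≡ ∑[ i < n ] f i
sumF≡∑ n f = trans (cong List.sum (map-tabulate id f)) (∑-tabulate n f)

sumF³≡∑³ : ∀ n m k (f : Fin n → Fin m → Fin k → ℕ) →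
  sumF n (λ i → sumF m (λ j → sumF k (f i j))) ≡ ∑[ i < n ] ∑[ j < m ] ∑[ l < k ] f i j l
sumF³≡∑³ n m k f = trans (sumF≡∑ n _) (sum-cong-≗ λ i →
  trans (sumF≡∑ m _) (sum-cong-≗ λ j → sumF≡∑ k (f i j)))

∑-mono-≤ : ∀ {n} {f g : Fin n → ℕ} → (∀ i → f i ≤ g i) → ∑[ i < n ] f i ≤ ∑[ i < n ] g i
∑-mono-≤ {zero} _ = z≤n
∑-mono-≤ {suc n} f≤g = +-mono-≤ (f≤g zero) (∑-mono-≤ (f≤g ∘ suc))

∑-one : ∀ n → ∑[ i < n ] 1 ≡ n
∑-one zero = refl
∑-one (suc n) = cong suc (∑-one n)

∑-splitAt : ∀ m n (f : Fin (m + n) → ℕ) →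
  ∑[ i < m + n ] f i ≡ ∑[ i < m ] f (i ↑ˡ n) + ∑[ j < n ] f (m ↑ʳ j)
∑-splitAt zero n f = refl
∑-splitAt (suc m) n f =
  trans (cong (f zero +_) (∑-splitAt m n (f ∘ suc))) (sym (+-assoc (f zero) _ _))

∑-combine : ∀ m n (f : Fin (m * n) → ℕ) →
  ∑[ i < m * n ] f i ≡ ∑[ r < m ] ∑[ j < n ] f (combine r j)
∑-combine zero n f = refl
∑-combine (suc m) n f = trans (∑-splitAt n (m * n) f)
  (cong (∑[ j < n ] f (j ↑ˡ m * n) +_) (∑-combine m n (f ∘ (n ↑ʳ_))))

∑-remQuot : ∀ m n (f : Fin m × Fin n → ℕ) →
  ∑[ i < m * n ] f (remQuot n i) ≡ ∑[ r < m ] ∑[ j < n ] f (r , j)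
∑-remQuot m n f = trans (∑-combine m n (f ∘ remQuot n))
  (sum-cong-≗ λ r → sum-cong-≗ λ j → cong f (remQuot-combine r j))

∑-indicator-none : ∀ {n} {P : Fin n → Set} (P? : ∀ i → Dec (P i)) →
  (∀ i → ¬ P i) → ∑[ i < n ] indicator (P? i) ≡ 0
∑-indicator-none {zero} _ _ = refl
∑-indicator-none {suc n} {P} P? ¬P =
  cong₂ _+_ (indicator-no (P? zero) (¬P zero))
            (∑-indicator-none {P = P ∘ suc} (P? ∘ suc) (¬P ∘ suc))

∑-indicator-unique : ∀ {n} {P : Fin n → Set} (P? : ∀ i → Dec (P i)) {i₀ : Fin n} →
  (∀ {i} → P i → i ≡ i₀) → P i₀ → ∑[ i < n ] indicator (P? i) ≡ 1
∑-indicator-unique {suc n} {P} P? {zero} unique p₀ =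
  cong₂ _+_ (indicator-yes (P? zero) p₀)
            (∑-indicator-none {P = P ∘ suc} (P? ∘ suc) (λ i p → case unique p of λ ()))
∑-indicator-unique {suc n} {P} P? {suc i₀} unique p₀ =
  cong₂ _+_ (indicator-no (P? zero) (λ p → case unique p of λ ()))
            (∑-indicator-unique {P = P ∘ suc} (P? ∘ suc) (suc-injective ∘ unique) p₀)

∑-indicator-bijective : ∀ {n} {f : Fin n → Fin n} → Bijective _≡_ _≡_ f →
  ∀ x → ∑[ i < n ] indicator (f i ≟F x) ≡ 1
∑-indicator-bijective {f = f} (injective , surjective) x =
  ∑-indicator-unique (λ i → f i ≟F x) (λ fi≡x → injective (trans fi≡x (sym fi₀≡x))) fi₀≡x
  where
  fi₀≡x : f (proj₁ (surjective x)) ≡ x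
  fi₀≡x = proj₂ (surjective x) refl

∑-indicator-×-≤ : ∀ {n} {E Q : Set} {P : Fin n → Set}
  (E? : Dec E) (P? : ∀ i → Dec (P i)) (Q? : Dec Q) →
  ∑[ i < n ] indicator (P? i) ≤ indicator Q? →
  ∑[ i < n ] indicator (E? ×-dec P? i) ≤ indicator (E? ×-dec Q?)
∑-indicator-×-≤ {n} E? P? Q? bound = begin
  ∑[ i < n ] indicator (E? ×-dec P? i)          ≡⟨ sum-cong-≗ (λ i → indicator-× E? (P? i)) ⟩
  ∑[ i < n ] (indicator E? * indicator (P? i))  ≡⟨ *-distribˡ-sum (indicator E?) (indicator ∘ P?) ⟨
  indicator E? * ∑[ i < n ] indicator (P? i)    ≤⟨ *-monoʳ-≤ (indicator E?) bound ⟩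
  indicator E? * indicator Q?                   ≡⟨ indicator-× E? Q? ⟨
  indicator (E? ×-dec Q?)                       ∎
  where open ≤-Reasoning

module Development {t : ℕ} (G : FinGroup t) where
  open FinGroup G

  group : Group _ _
  group = record { isGroup = isGroup }

  open Group group using (_\\_; _//_; assoc; identityʳ)
  open GroupProperties group
    using (quasigroup; ⁻¹-anti-homo-∙; \\-leftDividesˡ; \\-leftDividesʳ; //-rightDividesˡ)
  open QuasigroupProperties quasigroup using (cancelˡ; cancelʳ)

  ∙-bijectiveˡ : ∀ g → Bijective _≡_ _≡_ (g ∙_)
  ∙-bijectiveˡ g = (λ {y} {z} → cancelˡ g y z) , λ x → g \\ x , λ { refl → \\-leftDividesˡ g x }

  ∙-bijectiveʳ : ∀ c → Bijective _≡_ _≡_ (_∙ c)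
  ∙-bijectiveʳ c = (λ {y} {z} → cancelʳ c y z) , λ x → x // c , λ { refl → //-rightDividesˡ c x }

  \\-translation-invariant : ∀ {g a b x y} → g ∙ a ≡ x → g ∙ b ≡ y → a \\ b ≡ x \\ y
  \\-translation-invariant {g} {a} {b} refl refl = begin
    a \\ b                         ≡⟨ cong (a \\_) (\\-leftDividesʳ g b) ⟨
    (a ⁻¹) ∙ ((g ⁻¹) ∙ (g ∙ b))   ≡⟨ assoc (a ⁻¹) (g ⁻¹) (g ∙ b) ⟨
    ((a ⁻¹) ∙ (g ⁻¹)) ∙ (g ∙ b)   ≡⟨ cong (_∙ (g ∙ b)) (⁻¹-anti-homo-∙ g a) ⟨
    (g ∙ a) \\ (g ∙ b)             ∎
    where open ≡-Reasoning

  \\-≢ε : ∀ {x y} → x ≢ y → x \\ y ≢ ε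
  \\-≢ε {x} {y} x≢y x\\y≡ε = x≢y (begin
    x              ≡⟨ identityʳ x ⟨
    x ∙ ε          ≡⟨ cong (x ∙_) x\\y≡ε ⟨
    x ∙ (x \\ y)   ≡⟨ \\-leftDividesˡ x y ⟩
    y              ∎)
    where open ≡-Reasoning

  ∑-translations-≤ : ∀ a b x y →
    ∑[ g < t ] indicator ((g ∙ a ≟F x) ×-dec (g ∙ b ≟F y)) ≤ indicator (a \\ b ≟F x \\ y)
  ∑-translations-≤ a b x y with a \\ b ≟F x \\ y
  ... | yes _ = begin
    ∑[ g < t ] indicator ((g ∙ a ≟F x) ×-dec (g ∙ b ≟F y))
      ≤⟨ ∑-mono-≤ (λ g → indicator-×-≤ˡ (g ∙ a ≟F x) (g ∙ b ≟F y)) ⟩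
    ∑[ g < t ] indicator (g ∙ a ≟F x)
      ≡⟨ ∑-indicator-bijective (∙-bijectiveʳ a) x ⟩
    1 ∎
    where open ≤-Reasoning
  ... | no a\\b≢x\\y = ≤-reflexive (∑-indicator-none (λ g → (g ∙ a ≟F x) ×-dec (g ∙ b ≟F y))
    λ { g (ga≡x , gb≡y) → a\\b≢x\\y (\\-translation-invariant ga≡x gb≡y) })

  module _ {ℓ : ℕ} (A : Fin ℓ → Arrangement t) where

    private
      a : Fin ℓ → Fin t → Fin t
      a r = Arrangement.arr (A r)

    developedRow : Fin ℓ × Fin t → Fin t → Fin t
    developedRow (r , g) p = g ∙ a r p

    development : Design (ℓ * t) t
    development i = developedRow (remQuot {ℓ} t i)

    development-uniform : Uniform ℓ t development
    development-uniform = rows , columns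
      where
      rows : ∀ i x → count t (λ p → development i p ≟F x) ≡ 1
      rows i x = trans (sumF≡∑ t _) (∑-indicator-bijective
        (Composition.bijective _≡_ _≡_ _≡_ (Arrangement.bij (A r)) (∙-bijectiveˡ g)) x)
        where
        r : Fin ℓ
        r = proj₁ (remQuot {ℓ} t i)
        g : Fin t
        g = proj₂ (remQuot {ℓ} t i)

      columns : ∀ p x → count (ℓ * t) (λ i → development i p ≟F x) ≡ ℓ
      columns p x = begin
        count (ℓ * t) (λ i → development i p ≟F x)
          ≡⟨ sumF≡∑ (ℓ * t) _ ⟩
        ∑[ i < ℓ * t ] indicator (development i p ≟F x)
          ≡⟨ ∑-remQuot ℓ t (λ q → indicator (developedRow q p ≟F x)) ⟩
        ∑[ r < ℓ ] ∑[ g < t ] indicator (g ∙ a r p ≟F x)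
          ≡⟨ sum-cong-≗ (λ r → ∑-indicator-bijective (∙-bijectiveʳ (a r p)) x) ⟩
        ∑[ r < ℓ ] 1
          ≡⟨ ∑-one ℓ ⟩
        ℓ ∎
        where open ≡-Reasoning

    development-roman : ∀ k → RomanTuple G k ℓ A → RomanDesign k ℓ t development
    development-roman k roman x y x≢y d 1≤d d≤k = begin
      o development d x y
        ≡⟨ sumF³≡∑³ (ℓ * t) t t _ ⟩
      ∑[ i < ℓ * t ] ∑[ p < t ] ∑[ p' < t ]
        indicator (lag? p p' ×-dec ((development i p ≟F x) ×-dec (development i p' ≟F y)))
        ≡⟨ ∑-remQuot ℓ t (λ q → ∑[ p < t ] ∑[ p' < t ]
             indicator (lag? p p' ×-dec ((developedRow q p ≟F x) ×-dec (developedRow q p' ≟F y)))) ⟩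
      ∑[ r < ℓ ] ∑[ g < t ] ∑[ p < t ] ∑[ p' < t ] pairs r g p p'
        ≡⟨ sum-cong-≗ (λ r → trans (∑-comm (λ g p → ∑[ p' < t ] pairs r g p p'))
                                    (sum-cong-≗ λ p → ∑-comm (λ g p' → pairs r g p p'))) ⟩
      ∑[ r < ℓ ] ∑[ p < t ] ∑[ p' < t ] ∑[ g < t ] pairs r g p p'
        ≤⟨ ∑-mono-≤ (λ r → ∑-mono-≤ λ p → ∑-mono-≤ λ p' →
             ∑-indicator-×-≤ (lag? p p') (λ g → (g ∙ a r p ≟F x) ×-dec (g ∙ a r p' ≟F y))
               (a r p \\ a r p' ≟F x \\ y) (∑-translations-≤ (a r p) (a r p') x y)) ⟩
      ∑[ r < ℓ ] ∑[ p < t ] ∑[ p' < t ] indicator (lag? p p' ×-dec (a r p \\ a r p' ≟F x \\ y))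
        ≡⟨ sumF³≡∑³ ℓ t t _ ⟨
      occU G A d (x \\ y)
        ≤⟨ roman (x \\ y) (\\-≢ε x≢y) d 1≤d d≤k ⟩
      ℓ ∎
      where
      open ≤-Reasoning

      lag? : (p p' : Fin t) → Dec (toℕ p' ≡ toℕ p + d)
      lag? p p' = toℕ p' ≟ℕ (toℕ p + d)

      pairs : Fin ℓ → Fin t → Fin t → Fin t → ℕ
      pairs r g p p' = indicator (lag? p p' ×-dec ((g ∙ a r p ≟F x) ×-dec (g ∙ a r p' ≟F y)))

theorem5 : (t : ℕ) (G : FinGroup t) (k ℓ : ℕ) → 1 ≤ k → 1 ≤ ℓ →
    Σ (Fin ℓ → Arrangement t) (RomanTuple G k ℓ) →
    Σ (Design (ℓ * t) t) (λ D → Uniform ℓ t D × RomanDesign k ℓ t D)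
theorem5 t G k ℓ _ _ (A , roman) =
  development A , development-uniform A , development-roman A k roman
  where open Development G
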